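{- Let $k\ge 1$ be an integer and define $f:\mathbb{N}^k\to\mathbb{Z}$ by \[f(n_1,\dots,n_k)=\sum_{d_1\mid n_1,\dots,d_k\mid n_k}\mu(n_1/d_1)\cdots\mu(n_k/d_k)\,\frac{d_1\cdots d_k}{[d_1,\dots,d_k]}.\] Then $f(n_1,\dots,n_k)\ge 0$ for all $(n_1,\dots,n_k)\in\mathbb{N}^k$.
   Context: $\mu$ is the Möbius function and $[d_1,\dots,d_k]$ denotes the least common multiple. -}

module Defs where

open import Data.Nat using (ℕ; zero; suc; _*_; _/_; _^_)
open import Data.Nat.Divisibility using (_∣_; _∣?_)
open import Data.Nat.LCM using (lcm)
open import Data.Nat.Primality using (prime?)
open import Data.Integer as ℤ using (ℤ; +_; -_)
open import Data.List using (List; []; _∷_; filter; map; concatMap; length; foldr; applyUpTo)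
open import Data.Vec using (Vec; []; _∷_)
open import Data.Bool using (Bool; true; false; if_then_else_)
open import Relation.Nullary.Decidable using (does; ¬?)

divisors : ℕ → List ℕ
divisors n = filter (_∣? n) (applyUpTo suc n)

-- n is squarefree iff no d ≥ 2 has d² ∣ n  (d ranges over 2..n, enough for n ≥ 1)
squarefree : ℕ → Bool
squarefree n = foldr (λ d b → if does ((d * d) ∣? n) then false else b) true
                   (applyUpTo (λ i → suc (suc i)) n)

ω : ℕ → ℕ
ω n = length (filter prime? (divisors n))

μ : ℕ → ℤ
μ n = if squarefree n then (- (+ 1)) ℤ.^ ω n else + 0

lcmL : List ℕ → ℕ
lcmL = foldr lcm 1

prodL : List ℕ → ℕ
prodL = foldr _*_ 1

-- exact division a / b, with the (never used) convention a / 0 = 0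
_div_ : ℕ → ℕ → ℕ
a div zero    = 0
a div (suc b) = a / suc b

divisorTuples : ∀ {k} → Vec ℕ k → List (List ℕ)
divisorTuples []       = [] ∷ []
divisorTuples (n ∷ ns) =
  concatMap (λ d → map (d ∷_) (divisorTuples ns)) (divisors n)

μprod : ∀ {k} → Vec ℕ k → List ℕ → ℤ
μprod []       _        = + 1
μprod (n ∷ ns) []       = + 1
μprod (n ∷ ns) (d ∷ ds) = μ (n div d) ℤ.* μprod ns ds

f : ∀ {k} → Vec ℕ k → ℤ
f ns = foldr ℤ._+_ (+ 0)
         (map (λ ds → μprod ns ds ℤ.* (+ (prodL ds div lcmL ds))) (divisorTuples ns))

-- Put M = n₁⋯n_k and encode a fraction a/d with d ∣ M as the residue a·(M/d) modulo M.
-- For divisors dᵢ ∣ M, the number of tuples 0 ≤ aᵢ < dᵢ with Σ aᵢ/dᵢ ∈ ℤ is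
-- d₁⋯d_k/[d₁,…,d_k]: adding one coordinate means counting the solutions of a single linear
-- congruence. Möbius inversion in each coordinate,
--   Σ_{d ∣ n} μ(n/d) Σ_{a<d} Φ(a/d) = Σ_{a<n, (a,n)=1} Φ(a/n),
-- then turns f(n₁,…,n_k) into the number of tuples of reduced fractions aᵢ/nᵢ ∈ [0,1)
-- whose sum is an integer, which is non-negative.
module Submission where

open import Data.Bool using (Bool; true; false; if_then_else_)
open import Data.Integer as ℤ using (ℤ)
import Data.Integer.Properties as ℤ
open import Data.List using (List; []; _∷_; _++_; foldr; map; filter; applyUpTo; length; concatMap)
open import Data.List.Properties using (map-++; map-cong; map-cong-local; map-∘)
import Data.List.Relation.Unary.All as ListAll
open import Data.List.Relation.Unary.All using ([]; _∷_)
open import Data.List.Relation.Unary.All.Properties using (concat⁺; map⁺; all-filter)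
open import Data.Nat as ℕ using (ℕ; zero; suc; _<_; _≥_; _≟_; z≤n; s≤s; NonZero)
import Data.Nat.Properties as ℕ
open import Data.Nat.Coprimality using (Coprime; coprime?; coprime-divisor; coprime-Bézout; coprime-/gcd; coprime⇒gcd≡1)
import Data.Nat.Coprimality as Coprime
open import Data.Nat.Divisibility
open import Data.Nat.GCD using (gcd; module Bézout; gcd-comm; gcd[m,n]∣m; gcd[m,n]∣n; gcd-greatest; c*gcd[m,n]≡gcd[cm,cn]; gcd[m,n]≢0)
open import Data.Nat.LCM using (lcm; gcd*lcm; lcm-least)
open import Data.Nat.ListAction using (product)
open import Data.Nat.ListAction.Properties using (product≢0; ∈⇒∣product)
open import Data.Nat.Primality using (Prime; prime?; euclidsLemma; prime⇒irreducible; prime⇒nonZero; prime⇒nonTrivial; ¬prime[1])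
open import Data.Nat.Primality.Factorisation using (factorise)
open import Data.Nat.Tactic.RingSolver using (solve-∀)
open import Data.Product using (∃-syntax; _×_; _,_)
open import Data.Sum using (inj₁; inj₂; [_,_]′)
open import Data.Vec using (Vec; []; _∷_; toList)
open import Data.Vec.Relation.Unary.All as All using (All; []; _∷_)
open import Data.Vec.Relation.Unary.All.Properties using (toList⁺; toList⁻)
open import Function using (_∘_; _⇔_; mk⇔; Equivalence; it)
open import Function.Properties.Equivalence using () renaming (trans to ⇔-trans; sym to ⇔-sym)
open import Level using (Level)
open import Relation.Binary.PropositionalEquality
open import Relation.Nullary using (Dec; yes; no; ¬_; does; contradiction)
open import Relation.Nullary.Decidable using (¬?)
open import Relation.Unary using (Decidable)

open import Defs

module NatArithmetic where

  open import Data.List.Relation.Unary.Any as Any using (Any; here; there)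
  import Data.List.Relation.Unary.Any.Properties as Any
  open import Data.Nat
  open import Data.Nat.Properties
  open import Data.Nat.DivMod using (_%_; m*n/n≡m; m/n*n≡m; m≡m%n+[m/n]*n; m%n<n)
  open import Algebra.Properties.CommutativeSemigroup *-commutativeSemigroup using ()
    renaming (x∙yz≈y∙xz to x*[y*z]≡y*[x*z]; xy∙z≈xz∙y to x*y*z≡x*z*y;
              xy∙z≈zx∙y to x*y*z≡z*x*y; xy∙z≈x∙zy to x*y*z≡x*[z*y])

  private variable d m n p q r s v w : ℕ

  div≡/ : ∀ m n .{{_ : NonZero n}} → m div n ≡ m / n
  div≡/ m (suc n) = refl

  m*n-div-n≡m : ∀ m n .{{_ : NonZero n}} → (m * n) div n ≡ m
  m*n-div-n≡m m n = trans (div≡/ (m * n) n) (m*n/n≡m m n)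

  ∣⇒nonZero : .{{_ : NonZero n}} → m ∣ n → NonZero m
  ∣⇒nonZero {m = m} (divides q n≡qm) = m*n≢0⇒n≢0 q {{subst NonZero n≡qm it}}

  m-div-n*n≡m : .{{_ : NonZero n}} → n ∣ m → (m div n) * n ≡ m
  m-div-n*n≡m {n} {m} n∣m = trans (cong (_* n) (div≡/ m n)) (m/n*n≡m n∣m)

  m-div-n≢0 : .{{_ : NonZero m}} .{{_ : NonZero n}} → n ∣ m → NonZero (m div n)
  m-div-n≢0 {m} {n} n∣m = ∣⇒nonZero (divides n (trans (sym (m-div-n*n≡m n∣m)) (*-comm (m div n) n)))

  m≡q*n⇒m-div-n≡q : ∀ q n .{{_ : NonZero n}} → m ≡ q * n → m div n ≡ q
  m≡q*n⇒m-div-n≡q q n refl = m*n-div-n≡m q n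

  HasSquareDivisor : ℕ → Set
  HasSquareDivisor n = ∃[ d ] 2 ≤ d × d * d ∣ n

  squarefree≡false⇔ : ∀ n .{{_ : NonZero n}} → squarefree n ≡ false ⇔ HasSquareDivisor n
  squarefree≡false⇔ n = mk⇔ to from
    where
    step : ℕ → Bool → Bool
    step d b = if does (d * d ∣? n) then false else b

    fold≡false⇒any : ∀ ds → foldr step true ds ≡ false → Any (λ d → d * d ∣ n) ds
    fold≡false⇒any (d ∷ ds) eq with d * d ∣? n
    ... | yes dd∣n = here dd∣n
    ... | no  _    = there (fold≡false⇒any ds eq)

    any⇒fold≡false : ∀ {ds} → Any (λ d → d * d ∣ n) ds → foldr step true ds ≡ false
    any⇒fold≡false {d ∷ _} (here dd∣n) with d * d ∣? n
    ... | yes _    = refl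
    ... | no ¬dd∣n = contradiction dd∣n ¬dd∣n
    any⇒fold≡false {d ∷ _} (there any) with d * d ∣? n
    ... | yes _ = refl
    ... | no  _ = any⇒fold≡false any

    to : squarefree n ≡ false → HasSquareDivisor n
    to eq with Any.applyUpTo⁻ (λ i → 2 + i) (fold≡false⇒any (applyUpTo (λ i → 2 + i) n) eq)
    ... | i , _ , dd∣n = 2 + i , s≤s (s≤s z≤n) , dd∣n

    from : HasSquareDivisor n → squarefree n ≡ false
    from (suc (suc i) , s≤s (s≤s _) , dd∣n) = any⇒fold≡false (Any.applyUpTo⁺ (λ i → 2 + i) dd∣n i<n)
      where
      i<n : i < n
      i<n = <-≤-trans (<-trans (n<1+n i) (n<1+n (suc i)))
                      (≤-trans (m≤m*n (2 + i) (2 + i)) (∣⇒≤ dd∣n))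

  private
    ≡false⇔≡false⇒≡ : ∀ {b c : Bool} → b ≡ false ⇔ c ≡ false → b ≡ c
    ≡false⇔≡false⇒≡ {true}  {true}  _   = refl
    ≡false⇔≡false⇒≡ {false} {false} _   = refl
    ≡false⇔≡false⇒≡ {true}  {false} b⇔c = Equivalence.from b⇔c refl
    ≡false⇔≡false⇒≡ {false} {true}  b⇔c = sym (Equivalence.to b⇔c refl)

  squarefree-cong : ∀ m n .{{_ : NonZero m}} .{{_ : NonZero n}} →
                    HasSquareDivisor m ⇔ HasSquareDivisor n → squarefree m ≡ squarefree n
  squarefree-cong m n m⇔n =
    ≡false⇔≡false⇒≡ (⇔-trans (squarefree≡false⇔ m) (⇔-trans m⇔n (⇔-sym (squarefree≡false⇔ n))))

  prime∤⇒coprime : Prime p → ¬ p ∣ n → Coprime p n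
  prime∤⇒coprime prime-p p∤n (c∣p , c∣n) with prime⇒irreducible prime-p c∣p
  ... | inj₁ c≡1    = c≡1
  ... | inj₂ refl   = contradiction c∣n p∤n

  square-divisor-of-p*s : Prime p → ¬ p ∣ s → d * d ∣ p * s → d * d ∣ s
  square-divisor-of-p*s {p} {s} {d} prime-p p∤s dd∣ps =
    coprime-divisor (Coprime.sym (prime∤⇒coprime prime-p p∤dd)) dd∣ps
    where
    instance _ = prime⇒nonZero prime-p
    p∤d : ¬ p ∣ d
    p∤d p∣d = p∤s (*-cancelˡ-∣ p (∣-trans (*-pres-∣ p∣d p∣d) dd∣ps))
    p∤dd : ¬ p ∣ d * d
    p∤dd p∣dd = [ p∤d , p∤d ]′ (euclidsLemma d d prime-p p∣dd)

  ∃-prime-divisor : ∀ n → 2 ≤ n → ∃[ p ] Prime p × p ∣ n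
  ∃-prime-divisor n@(suc (suc _)) _ with factorise n
  ... | record { factors = [] ; isFactorisation = () }
  ... | record { factors = p ∷ ps ; isFactorisation = n≡∏ ; factorsPrime = prime-p ∷ _ } =
    p , prime-p , subst (p ∣_) (sym n≡∏) (m∣m*n (product ps))
  ∃-prime-divisor 1 (s≤s ())

  prime-divisor-of-p*s : Prime p → Prime q → q ≢ p → q ∣ p * s → q ∣ s
  prime-divisor-of-p*s {p} {q} {s} prime-p prime-q q≢p q∣ps with euclidsLemma p s prime-q q∣ps
  ... | inj₂ q∣s = q∣s
  ... | inj₁ q∣p with prime⇒irreducible prime-p q∣p
  ...   | inj₁ refl = contradiction prime-q ¬prime[1]
  ...   | inj₂ q≡p  = contradiction q≡p q≢p

  private
    congruence-unique-≤ : Coprime n w → m ≤ d → d < n → n ∣ r + m * w → n ∣ r + d * w → m ≡ d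
    congruence-unique-≤ {n} {w} {m} {d} {r} coprime m≤d d<n n∣m n∣d with m≤n⇒∃[o]m+o≡n m≤d
    ... | zero  , refl = sym (+-identityʳ m)
    ... | suc k , refl = contradiction (coprime-divisor coprime n∣w*k) (>⇒∤ (≤-<-trans (m≤n+m (suc k) m) d<n))
      where
      split : ∀ r a k w → r + (a + k) * w ≡ (r + a * w) + w * k
      split = solve-∀
      n∣w*k : n ∣ w * suc k
      n∣w*k = ∣m+n∣m⇒∣n (subst (n ∣_) (split r m (suc k) w) n∣d) n∣m

  congruence-unique : Coprime n w → m < n → d < n → n ∣ r + m * w → n ∣ r + d * w → m ≡ d
  congruence-unique {m = m} {d} coprime m<n d<n n∣m n∣d with ≤-total m d
  ... | inj₁ m≤d = congruence-unique-≤ coprime m≤d d<n n∣m n∣d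
  ... | inj₂ d≤m = sym (congruence-unique-≤ coprime d≤m m<n n∣d n∣m)

  private
    -- Bézout makes y a negative inverse, resp. an inverse, of w modulo n; so b = r y, resp. b = (n - 1) r y.
    congruence-solvable′ : ∀ n .{{_ : NonZero n}} w r → Coprime n w → ∃[ b ] n ∣ r + b * w
    congruence-solvable′ n w r coprime with coprime-Bézout coprime
    ... | Bézout.+- x y 1+yw≡xn = r * y , divides (r * x) (begin
      r + r * y * w     ≡⟨ factor r y w ⟩
      r * (1 + y * w)   ≡⟨ cong (r *_) 1+yw≡xn ⟩
      r * (x * n)       ≡⟨ *-assoc r x n ⟨
      r * x * n         ∎)
      where
      open ≡-Reasoning
      factor : ∀ r y w → r + r * y * w ≡ r * (1 + y * w)
      factor = solve-∀
    congruence-solvable′ n@(suc n₁) w r coprime | Bézout.-+ x y 1+xn≡yw =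
      n₁ * r * y , divides (r + n₁ * r * x) (begin
        r + n₁ * r * y * w        ≡⟨ cong (r +_) (*-assoc (n₁ * r) y w) ⟩
        r + n₁ * r * (y * w)      ≡⟨ cong (λ t → r + n₁ * r * t) 1+xn≡yw ⟨
        r + n₁ * r * (1 + x * n)  ≡⟨ factor r n₁ x ⟩
        (r + n₁ * r * x) * n      ∎)
      where
      open ≡-Reasoning
      factor : ∀ r n₁ x → r + n₁ * r * (1 + x * suc n₁) ≡ (r + n₁ * r * x) * suc n₁
      factor = solve-∀

  congruence-solvable : ∀ n .{{_ : NonZero n}} w r → Coprime n w → ∃[ b ] b < n × n ∣ r + b * w
  congruence-solvable n w r coprime with congruence-solvable′ n w r coprime
  ... | b , n∣r+bw = b % n , m%n<n b n , ∣m+n∣m⇒∣n (subst (n ∣_) reduce n∣r+bw) (∣m⇒∣m*n w (n∣m*n (b / n)))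
    where
    open ≡-Reasoning
    shuffle : ∀ r s t w → r + (s + t) * w ≡ t * w + (r + s * w)
    shuffle = solve-∀
    reduce : r + b * w ≡ b / n * n * w + (r + b % n * w)
    reduce = begin
      r + b * w                        ≡⟨ cong (λ t → r + t * w) (m≡m%n+[m/n]*n b n) ⟩
      r + (b % n + b / n * n) * w      ≡⟨ shuffle r (b % n) (b / n * n) w ⟩
      b / n * n * w + (r + b % n * w)  ∎

  lcm[m,n]*gcd[u,v]≡u*m : ∀ u v m n .{{_ : NonZero m}} → u * m ≡ v * n → lcm m n * gcd u v ≡ u * m
  lcm[m,n]*gcd[u,v]≡u*m u v m n um≡vn = *-cancelˡ-≡ _ _ (gcd m n) {{gcd≢0}} (begin
    gcd m n * (lcm m n * gcd u v)  ≡⟨ *-assoc (gcd m n) (lcm m n) (gcd u v) ⟨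
    gcd m n * lcm m n * gcd u v    ≡⟨ cong (_* gcd u v) (gcd*lcm m n) ⟩
    m * n * gcd u v                ≡⟨ c*gcd[m,n]≡gcd[cm,cn] (m * n) u v ⟩
    gcd (m * n * u) (m * n * v)    ≡⟨ cong₂ gcd (x*y*z≡z*x*y m n u) (trans (x*y*z≡x*[z*y] m n v) (cong (m *_) (sym um≡vn))) ⟩
    gcd (u * m * n) (m * (u * m))  ≡⟨ cong (gcd (u * m * n)) (*-comm m (u * m)) ⟩
    gcd (u * m * n) (u * m * m)    ≡⟨ c*gcd[m,n]≡gcd[cm,cn] (u * m) n m ⟨
    u * m * gcd n m                ≡⟨ cong (u * m *_) (gcd-comm n m) ⟩
    u * m * gcd m n                ≡⟨ *-comm (u * m) (gcd m n) ⟩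
    gcd m n * (u * m)              ∎)
    where
    open ≡-Reasoning
    gcd≢0 : NonZero (gcd m n)
    gcd≢0 = ≢-nonZero (gcd[m,n]≢0 m n (inj₁ (≢-nonZero⁻¹ m)))

  m*gcd[u,v]≡gcd[m,n]*v : ∀ u v m n .{{_ : NonZero m}} .{{_ : NonZero n}} → u * m ≡ v * n →
                           m * gcd u v ≡ gcd m n * v
  m*gcd[u,v]≡gcd[m,n]*v u v m n um≡vn = *-cancelʳ-≡ _ _ n (begin
    m * gcd u v * n                ≡⟨ x*y*z≡x*z*y m (gcd u v) n ⟩
    m * n * gcd u v                ≡⟨ cong (_* gcd u v) (gcd*lcm m n) ⟨
    gcd m n * lcm m n * gcd u v    ≡⟨ *-assoc (gcd m n) (lcm m n) (gcd u v) ⟩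
    gcd m n * (lcm m n * gcd u v)  ≡⟨ cong (gcd m n *_) (trans (lcm[m,n]*gcd[u,v]≡u*m u v m n um≡vn) um≡vn) ⟩
    gcd m n * (v * n)              ≡⟨ *-assoc (gcd m n) v n ⟨
    gcd m n * v * n                ∎)
    where open ≡-Reasoning

  m*[c*n]-div-lcm≡gcd*c : ∀ m n c .{{_ : NonZero (lcm m n)}} → (m * (c * n)) div lcm m n ≡ gcd m n * c
  m*[c*n]-div-lcm≡gcd*c m n c = m≡q*n⇒m-div-n≡q (gcd m n * c) (lcm m n) (begin
    m * (c * n)              ≡⟨ x*[y*z]≡y*[x*z] m c n ⟩
    c * (m * n)              ≡⟨ cong (c *_) (gcd*lcm m n) ⟨
    c * (gcd m n * lcm m n)  ≡⟨ trans (*-assoc (gcd m n) c (lcm m n)) (x*[y*z]≡y*[x*z] (gcd m n) c (lcm m n)) ⟨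
    gcd m n * c * lcm m n    ∎)
    where open ≡-Reasoning

  -- x / M in lowest terms has denominator M / gcd x M.
  denominator : ℕ → ℕ → ℕ
  denominator x M = M div gcd x M

  module _ {x M : ℕ} .{{_ : NonZero M}} where

    private
      g = gcd x M
      e = denominator x M

      instance
        g≢0 : NonZero g
        g≢0 = ≢-nonZero (gcd[m,n]≢0 x M (inj₂ (≢-nonZero⁻¹ M)))

      M≡e*g : M ≡ e * g
      M≡e*g = sym (trans (cong (_* g) (div≡/ M g)) (m/n*n≡m (gcd[m,n]∣n x M)))

    denominator≢0 : NonZero (denominator x M)
    denominator≢0 = m*n≢0⇒m≢0 e {{subst NonZero M≡e*g it}}

    private instance _ = denominator≢0

    denominator-∣⇔ : M ≡ v * d → v ∣ x ⇔ denominator x M ∣ d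
    denominator-∣⇔ {v} {d} M≡vd = mk⇔ to from
      where
      open ≡-Reasoning
      instance
        v≢0 : NonZero v
        v≢0 = m*n≢0⇒m≢0 v {{subst NonZero M≡vd it}}
      to : v ∣ x → e ∣ d
      to v∣x with gcd-greatest v∣x (divides d (trans M≡vd (*-comm v d)))
      ... | divides h g≡hv = divides h (*-cancelˡ-≡ d (h * e) v (begin
        v * d        ≡⟨ M≡vd ⟨
        M            ≡⟨ M≡e*g ⟩
        e * g        ≡⟨ cong (e *_) g≡hv ⟩
        e * (h * v)  ≡⟨ reorder e h v ⟩
        v * (h * e)  ∎))
        where reorder : ∀ e h v → e * (h * v) ≡ v * (h * e)
              reorder = solve-∀
      from : e ∣ d → v ∣ x
      from (divides h d≡he) = ∣-trans (divides h g≡hv) (gcd[m,n]∣m x M)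
        where
        g≡hv : g ≡ h * v
        g≡hv = *-cancelˡ-≡ g (h * v) e (begin
          e * g        ≡⟨ M≡e*g ⟨
          M            ≡⟨ M≡vd ⟩
          v * d        ≡⟨ cong (v *_) d≡he ⟩
          v * (h * e)  ≡⟨ reorder v h e ⟩
          e * (h * v)  ∎)
          where reorder : ∀ v h e → v * (h * e) ≡ e * (h * v)
                reorder = solve-∀

    denominator≡⇔ : M ≡ p * n → denominator x M ≡ n ⇔ (p ∣ x × Coprime (x div p) n)
    denominator≡⇔ {p} {n} M≡pn = mk⇔ to from
      where
      open ≡-Reasoning
      instance
        p≢0 : NonZero p
        p≢0 = m*n≢0⇒m≢0 p {{subst NonZero M≡pn it}}
        n≢0 : NonZero n
        n≢0 = m*n≢0⇒n≢0 p {{subst NonZero M≡pn it}}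
      to : e ≡ n → p ∣ x × Coprime (x div p) n
      to e≡n = subst (_∣ x) g≡p (gcd[m,n]∣m x M) ,
               subst₂ Coprime (trans (sym (div≡/ x g)) (cong (x div_) g≡p))
                              (trans (sym (div≡/ M g)) e≡n)
                              (coprime-/gcd x M)
        where
        g≡p : g ≡ p
        g≡p = *-cancelˡ-≡ g p n (begin
          n * g  ≡⟨ cong (_* g) e≡n ⟨
          e * g  ≡⟨ M≡e*g ⟨
          M      ≡⟨ M≡pn ⟩
          p * n  ≡⟨ *-comm p n ⟩
          n * p  ∎)
      from : p ∣ x × Coprime (x div p) n → e ≡ n
      from (divides c x≡cp , coprime) = *-cancelʳ-≡ e n p (begin
        e * p  ≡⟨ cong (e *_) g≡p ⟨
        e * g  ≡⟨ M≡e*g ⟨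
        M      ≡⟨ M≡pn ⟩
        p * n  ≡⟨ *-comm p n ⟩
        n * p  ∎)
        where
        g≡p : g ≡ p
        g≡p = begin
          gcd x M              ≡⟨ cong₂ gcd (trans x≡cp (*-comm c p)) M≡pn ⟩
          gcd (p * c) (p * n)  ≡⟨ c*gcd[m,n]≡gcd[cm,cn] p c n ⟨
          p * gcd c n          ≡⟨ cong (p *_) (coprime⇒gcd≡1 (subst (λ y → Coprime y n) x-div-p≡c coprime)) ⟩
          p * 1                ≡⟨ *-identityʳ p ⟩
          p                    ∎
          where
          x-div-p≡c : x div p ≡ c
          x-div-p≡c = trans (cong (_div p) x≡cp) (m*n-div-n≡m c p)

open NatArithmetic

open import Data.Integer using (+_; -_; _+_; _*_; _≤_)
open import Algebra.Properties.CommutativeSemigroup ℤ.+-commutativeSemigroup using () renaming (interchange to +-interchange)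
open import Algebra.Properties.CommutativeSemigroup ℤ.*-commutativeSemigroup using () renaming (x∙yz≈y∙xz to x*[y*z]≡y*[x*z])

private variable
  ℓ₁ ℓ₂ ℓ₃ : Level
  P : Set ℓ₁
  Q : Set ℓ₂
  R : Set ℓ₃
  A : Set ℓ₁
  B : Set ℓ₂
  m n : ℕ
  F G : ℕ → ℤ

-- Indicators and finite sums

𝟙 : Dec P → ℤ
𝟙 (yes _) = + 1
𝟙 (no _)  = + 0

𝟙-yes : (P? : Dec P) → P → 𝟙 P? ≡ + 1
𝟙-yes (yes _) _  = refl
𝟙-yes (no ¬P) pf = contradiction pf ¬P

𝟙-no : (P? : Dec P) → ¬ P → 𝟙 P? ≡ + 0
𝟙-no (yes pf) ¬P = contradiction pf ¬P
𝟙-no (no _)   _  = refl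

𝟙-⇔ : (P? : Dec P) (Q? : Dec Q) → P ⇔ Q → 𝟙 P? ≡ 𝟙 Q?
𝟙-⇔ P? (yes pf) P⇔Q = 𝟙-yes P? (Equivalence.from P⇔Q pf)
𝟙-⇔ P? (no ¬Q)  P⇔Q = 𝟙-no P? (¬Q ∘ Equivalence.to P⇔Q)

𝟙-× : (P? : Dec P) (Q? : Dec Q) (R? : Dec R) →
      R ⇔ (P × Q) → 𝟙 P? * 𝟙 Q? ≡ 𝟙 R?
𝟙-× (yes pf) (yes qf) R? R⇔P×Q = sym (𝟙-yes R? (Equivalence.from R⇔P×Q (pf , qf)))
𝟙-× (yes _)  (no ¬Q)  R? R⇔P×Q = sym (𝟙-no R? λ rf → let _ , qf = Equivalence.to R⇔P×Q rf in ¬Q qf)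
𝟙-× (no ¬P)  Q?       R? R⇔P×Q = sym (𝟙-no R? λ rf → let pf , _ = Equivalence.to R⇔P×Q rf in ¬P pf)

0≤𝟙 : (P? : Dec P) → + 0 ≤ 𝟙 P?
0≤𝟙 (yes _) = ℤ.+≤+ z≤n
0≤𝟙 (no _)  = ℤ.≤-refl

0≤𝟙* : (P? : Dec P) {x : ℤ} → + 0 ≤ x → + 0 ≤ 𝟙 P? * x
0≤𝟙* (yes _) 0≤x = subst (+ 0 ≤_) (sym (ℤ.*-identityˡ _)) 0≤x
0≤𝟙* (no _)  _   = ℤ.≤-refl

𝟙-split : (P? : Dec P) (x : ℤ) → 𝟙 P? * x + 𝟙 (¬? P?) * x ≡ x
𝟙-split (yes _) x = trans (ℤ.+-identityʳ (+ 1 * x)) (ℤ.*-identityˡ x)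
𝟙-split (no _)  x = trans (ℤ.+-identityˡ (+ 1 * x)) (ℤ.*-identityˡ x)

∑< : ℕ → (ℕ → ℤ) → ℤ
∑< zero    F = + 0
∑< (suc n) F = F 0 + ∑< n (F ∘ suc)

infix 10 ∑<
syntax ∑< n (λ i → F) = ∑[ i < n ] F

∑-cong : ∀ n → (∀ i → F i ≡ G i) → ∑< n F ≡ ∑< n G
∑-cong zero    F≡G = refl
∑-cong (suc n) F≡G = cong₂ _+_ (F≡G 0) (∑-cong n (F≡G ∘ suc))

∑-vanishing : ∀ n → (∀ i → i < n → F i ≡ + 0) → ∑< n F ≡ + 0
∑-vanishing zero    F≡0 = refl
∑-vanishing (suc n) F≡0 = cong₂ _+_ (F≡0 0 (s≤s z≤n)) (∑-vanishing n λ i i<n → F≡0 (suc i) (s≤s i<n))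

∑-distrib-+ : ∀ n F G → ∑[ i < n ] (F i + G i) ≡ ∑< n F + ∑< n G
∑-distrib-+ zero    F G = refl
∑-distrib-+ (suc n) F G rewrite ∑-distrib-+ n (F ∘ suc) (G ∘ suc) =
  +-interchange (F 0) (G 0) (∑< n (F ∘ suc)) (∑< n (G ∘ suc))

*-distribˡ-∑ : ∀ n c F → c * ∑< n F ≡ ∑[ i < n ] (c * F i)
*-distribˡ-∑ zero    c F = ℤ.*-zeroʳ c
*-distribˡ-∑ (suc n) c F =
  trans (ℤ.*-distribˡ-+ c (F 0) _) (cong (_+_ (c * F 0)) (*-distribˡ-∑ n c (F ∘ suc)))

*-distribʳ-∑ : ∀ n c F → ∑< n F * c ≡ ∑[ i < n ] (F i * c)
*-distribʳ-∑ n c F = begin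
  ∑< n F * c           ≡⟨ ℤ.*-comm (∑< n F) c ⟩
  c * ∑< n F           ≡⟨ *-distribˡ-∑ n c F ⟩
  ∑[ i < n ] (c * F i) ≡⟨ ∑-cong n (λ i → ℤ.*-comm c (F i)) ⟩
  ∑[ i < n ] (F i * c) ∎
  where open ≡-Reasoning

neg-distrib-∑ : ∀ n F → - ∑< n F ≡ ∑[ i < n ] (- F i)
neg-distrib-∑ zero    F = refl
neg-distrib-∑ (suc n) F =
  trans (ℤ.neg-distrib-+ (F 0) _) (cong (_+_ (- F 0)) (neg-distrib-∑ n (F ∘ suc)))

∑-split : ∀ m n F → ∑< (m ℕ.+ n) F ≡ ∑< m F + ∑[ i < n ] F (m ℕ.+ i)
∑-split zero    n F = sym (ℤ.+-identityˡ _)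
∑-split (suc m) n F rewrite ∑-split m n (F ∘ suc) = sym (ℤ.+-assoc (F 0) _ _)

∑-extend : m ℕ.≤ n → (∀ i → m ℕ.≤ i → i < n → F i ≡ + 0) → ∑< m F ≡ ∑< n F
∑-extend {m} {n} {F} m≤n tail≡0 = begin
  ∑< m F                                 ≡⟨ ℤ.+-identityʳ (∑< m F) ⟨
  ∑< m F + + 0                           ≡⟨ cong (_+_ (∑< m F)) (∑-vanishing (n ℕ.∸ m) tail≡0′) ⟨
  ∑< m F + ∑[ i < n ℕ.∸ m ] F (m ℕ.+ i)  ≡⟨ ∑-split m (n ℕ.∸ m) F ⟨
  ∑< (m ℕ.+ (n ℕ.∸ m)) F                 ≡⟨ cong (λ k → ∑< k F) (ℕ.m+[n∸m]≡n m≤n) ⟩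
  ∑< n F                                 ∎
  where
  open ≡-Reasoning
  tail≡0′ : ∀ i → i < n ℕ.∸ m → F (m ℕ.+ i) ≡ + 0
  tail≡0′ i i<n∸m = tail≡0 (m ℕ.+ i) (ℕ.m≤m+n m i)
    (subst (m ℕ.+ i <_) (ℕ.m+[n∸m]≡n m≤n) (ℕ.+-monoʳ-< m i<n∸m))

∑-single : ∀ n c → c < n → (∀ i → i < n → i ≢ c → F i ≡ + 0) → ∑< n F ≡ F c
∑-single {F} (suc n) zero _ others≡0 =
  trans (cong (_+_ (F 0)) (∑-vanishing n λ i i<n → others≡0 (suc i) (s≤s i<n) λ ()))
        (ℤ.+-identityʳ _)
∑-single (suc n) (suc c) (s≤s c<n) others≡0 rewrite others≡0 0 (s≤s z≤n) (λ ()) =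
  trans (ℤ.+-identityˡ _)
        (∑-single n c c<n λ i i<n i≢c → others≡0 (suc i) (s≤s i<n) (i≢c ∘ ℕ.suc-injective))

∑-comm : ∀ m n (F : ℕ → ℕ → ℤ) → ∑[ i < m ] (∑[ j < n ] F i j) ≡ ∑[ j < n ] (∑[ i < m ] F i j)
∑-comm zero    n F = sym (∑-vanishing n λ _ _ → refl)
∑-comm (suc m) n F rewrite ∑-comm m n (F ∘ suc) = sym (∑-distrib-+ n (F 0) _)

0≤∑ : ∀ n → (∀ i → + 0 ≤ F i) → + 0 ≤ ∑< n F
0≤∑ zero    0≤F = ℤ.≤-refl
0≤∑ (suc n) 0≤F = ℤ.+-mono-≤ (0≤F 0) (0≤∑ n (0≤F ∘ suc))

∑-periodic : ∀ P q F → (∀ i → F (P ℕ.+ i) ≡ F i) → ∑< (q ℕ.* P) F ≡ + q * ∑< P F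
∑-periodic P zero    F periodic = sym (ℤ.*-zeroˡ (∑< P F))
∑-periodic P (suc q) F periodic = begin
  ∑< (P ℕ.+ q ℕ.* P) F                   ≡⟨ ∑-split P (q ℕ.* P) F ⟩
  ∑< P F + ∑[ i < q ℕ.* P ] F (P ℕ.+ i)  ≡⟨ cong (_+_ (∑< P F)) (∑-cong (q ℕ.* P) periodic) ⟩
  ∑< P F + ∑< (q ℕ.* P) F                ≡⟨ cong (_+_ (∑< P F)) (∑-periodic P q F periodic) ⟩
  ∑< P F + + q * ∑< P F                  ≡⟨ ℤ.suc-* (+ q) (∑< P F) ⟨
  + suc q * ∑< P F                       ∎
  where open ≡-Reasoning

∑-multiples : ∀ p .{{_ : NonZero p}} m (F : ℕ → ℤ) →
              ∑[ s < m ] F (s ℕ.* p) ≡ ∑[ x < m ℕ.* p ] (𝟙 (p ∣? x) * F x)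
∑-multiples p zero    F = refl
∑-multiples p (suc m) F = begin
  F 0 + ∑[ s < m ] F (p ℕ.+ s ℕ.* p)
    ≡⟨ cong₂ _+_ (sym first-block) (∑-multiples p m (F ∘ (p ℕ.+_))) ⟩
  ∑[ x < p ] (𝟙 (p ∣? x) * F x) + ∑[ x < m ℕ.* p ] (𝟙 (p ∣? x) * F (p ℕ.+ x))
    ≡⟨ cong (_+_ (∑[ x < p ] (𝟙 (p ∣? x) * F x))) (∑-cong (m ℕ.* p) shift) ⟩
  ∑[ x < p ] (𝟙 (p ∣? x) * F x) + ∑[ x < m ℕ.* p ] (𝟙 (p ∣? p ℕ.+ x) * F (p ℕ.+ x))
    ≡⟨ ∑-split p (m ℕ.* p) (λ x → 𝟙 (p ∣? x) * F x) ⟨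
  ∑[ x < p ℕ.+ m ℕ.* p ] (𝟙 (p ∣? x) * F x) ∎
  where
  open ≡-Reasoning
  first-block : ∑[ x < p ] (𝟙 (p ∣? x) * F x) ≡ F 0
  first-block = begin
    ∑[ x < p ] (𝟙 (p ∣? x) * F x) ≡⟨ ∑-single p 0 (ℕ.>-nonZero⁻¹ p) others≡0 ⟩
    𝟙 (p ∣? 0) * F 0              ≡⟨ cong (_* F 0) (𝟙-yes (p ∣? 0) (p ∣0)) ⟩
    + 1 * F 0                     ≡⟨ ℤ.*-identityˡ (F 0) ⟩
    F 0                           ∎
    where
    others≡0 : ∀ x → x < p → x ≢ 0 → 𝟙 (p ∣? x) * F x ≡ + 0
    others≡0 x x<p x≢0 = cong (_* F x) (𝟙-no (p ∣? x) λ p∣x →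
                           ℕ.<⇒≱ x<p (∣⇒≤ {{ℕ.≢-nonZero x≢0}} p∣x))
  shift : ∀ x → 𝟙 (p ∣? x) * F (p ℕ.+ x) ≡ 𝟙 (p ∣? p ℕ.+ x) * F (p ℕ.+ x)
  shift x = cong (_* F (p ℕ.+ x))
    (𝟙-⇔ (p ∣? x) (p ∣? p ℕ.+ x) (mk⇔ (∣m∣n⇒∣m+n ∣-refl) (λ p∣p+x → ∣m+n∣m⇒∣n p∣p+x ∣-refl)))

∑-as-multiples : ∀ {M d} .{{_ : NonZero M}} → d ∣ M → (Φ : ℕ → ℤ) →
                 ∑[ a < d ] Φ (a ℕ.* (M div d)) ≡ ∑[ x < M ] (𝟙 (M div d ∣? x) * Φ x)
∑-as-multiples {M} {d} d∣M Φ = begin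
  ∑[ a < d ] Φ (a ℕ.* (M div d))                         ≡⟨ ∑-multiples (M div d) d Φ ⟩
  ∑[ x < d ℕ.* (M div d) ] (𝟙 (M div d ∣? x) * Φ x)      ≡⟨ cong (λ k → ∑[ x < k ] (𝟙 (M div d ∣? x) * Φ x)) d*[M/d]≡M ⟩
  ∑[ x < M ] (𝟙 (M div d ∣? x) * Φ x)                    ∎
  where
  open ≡-Reasoning
  instance
    d≢0 : NonZero d
    d≢0 = ∣⇒nonZero d∣M
    M/d≢0 : NonZero (M div d)
    M/d≢0 = m-div-n≢0 d∣M
  d*[M/d]≡M : d ℕ.* (M div d) ≡ M
  d*[M/d]≡M = trans (ℕ.*-comm d (M div d)) (m-div-n*n≡m d∣M)

∑∣ : ℕ → (ℕ → ℤ) → ℤ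
∑∣ n F = ∑[ d < suc n ] (𝟙 (d ∣? n) * F d)

infix 10 ∑∣
syntax ∑∣ n (λ d → F) = ∑[ d ∣ n ] F

∑∣-extend : ∀ n N .{{_ : NonZero n}} → n ℕ.≤ N → ∑[ d ∣ n ] F d ≡ ∑[ d < suc N ] (𝟙 (d ∣? n) * F d)
∑∣-extend {F} n N n≤N = ∑-extend (s≤s n≤N) λ d n<d _ →
  cong (_* F d) (𝟙-no (d ∣? n) λ d∣n → ℕ.<⇒≱ n<d (∣⇒≤ d∣n))

∑∣-cong : ∀ n → (∀ d → d ∣ n → F d ≡ G d) → ∑[ d ∣ n ] F d ≡ ∑[ d ∣ n ] G d
∑∣-cong {F} {G} n F≡G = ∑-cong (suc n) guarded
  where
  guarded : ∀ d → 𝟙 (d ∣? n) * F d ≡ 𝟙 (d ∣? n) * G d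
  guarded d with d ∣? n
  ... | yes d∣n = cong (+ 1 *_) (F≡G d d∣n)
  ... | no  _   = refl

∑∣-distrib-+ : ∀ n (F G : ℕ → ℤ) → ∑[ d ∣ n ] (F d + G d) ≡ ∑[ d ∣ n ] F d + ∑[ d ∣ n ] G d
∑∣-distrib-+ n F G = trans (∑-cong (suc n) λ d → ℤ.*-distribˡ-+ (𝟙 (d ∣? n)) (F d) (G d))
                           (∑-distrib-+ (suc n) (λ d → 𝟙 (d ∣? n) * F d) (λ d → 𝟙 (d ∣? n) * G d))

∑∣-comm : ∀ n N (F : ℕ → ℕ → ℤ) → ∑[ d ∣ n ] (∑[ x < N ] F d x) ≡ ∑[ x < N ] (∑[ d ∣ n ] F d x)
∑∣-comm n N F = trans (∑-cong (suc n) λ d → *-distribˡ-∑ N (𝟙 (d ∣? n)) (F d))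
                      (∑-comm (suc n) N λ d x → 𝟙 (d ∣? n) * F d x)

*-distribʳ-∑∣ : ∀ n c (F : ℕ → ℤ) → ∑[ d ∣ n ] F d * c ≡ ∑[ d ∣ n ] (F d * c)
*-distribʳ-∑∣ n c F = trans (*-distribʳ-∑ (suc n) c λ d → 𝟙 (d ∣? n) * F d)
                            (∑-cong (suc n) λ d → ℤ.*-assoc (𝟙 (d ∣? n)) (F d) c)

∑∣-multiples : ∀ t e .{{_ : NonZero t}} .{{_ : NonZero e}} (F : ℕ → ℤ) →
               ∑[ d ∣ t ℕ.* e ] (𝟙 (e ∣? d) * F d) ≡ ∑[ s ∣ t ] F (s ℕ.* e)
∑∣-multiples t e F = begin
  ∑[ d ∣ t ℕ.* e ] (𝟙 (e ∣? d) * F d)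
    ≡⟨ ∑-cong (suc (t ℕ.* e)) (λ d → x*[y*z]≡y*[x*z] (𝟙 (d ∣? t ℕ.* e)) (𝟙 (e ∣? d)) (F d)) ⟩
  ∑[ d < suc (t ℕ.* e) ] (𝟙 (e ∣? d) * D d)  ≡⟨ ∑-extend (ℕ.+-monoˡ-≤ (t ℕ.* e) (ℕ.>-nonZero⁻¹ e)) beyond-te ⟩
  ∑[ d < suc t ℕ.* e ] (𝟙 (e ∣? d) * D d)    ≡⟨ ∑-multiples e (suc t) D ⟨
  ∑[ s < suc t ] D (s ℕ.* e)                 ≡⟨ ∑-cong (suc t) cancel-e ⟩
  ∑[ s ∣ t ] F (s ℕ.* e)                     ∎
  where
  open ≡-Reasoning
  instance
    te≢0 : NonZero (t ℕ.* e)
    te≢0 = ℕ.m*n≢0 t e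
  D : ℕ → ℤ
  D d = 𝟙 (d ∣? t ℕ.* e) * F d
  beyond-te : ∀ d → suc (t ℕ.* e) ℕ.≤ d → d < suc t ℕ.* e → 𝟙 (e ∣? d) * D d ≡ + 0
  beyond-te d te<d _ = trans (cong (λ z → 𝟙 (e ∣? d) * (z * F d))
                                   (𝟙-no (d ∣? t ℕ.* e) λ d∣te → ℕ.<⇒≱ te<d (∣⇒≤ d∣te)))
                             (ℤ.*-zeroʳ (𝟙 (e ∣? d)))
  cancel-e : ∀ s → D (s ℕ.* e) ≡ 𝟙 (s ∣? t) * F (s ℕ.* e)
  cancel-e s = cong (_* F (s ℕ.* e)) (𝟙-⇔ (s ℕ.* e ∣? t ℕ.* e) (s ∣? t) (mk⇔ (*-cancelʳ-∣ e) (*-monoˡ-∣ e)))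

∑∣-split-prime : ∀ {p} m → Prime p → .{{_ : NonZero m}} (F : ℕ → ℤ) →
                 ∑[ d ∣ m ℕ.* p ] F d ≡ ∑[ s ∣ m ] (F (s ℕ.* p) + 𝟙 (¬? (p ∣? s)) * F s)
∑∣-split-prime {p} m prime-p F = begin
  ∑[ d ∣ m ℕ.* p ] F d
    ≡⟨ ∑-cong (suc (m ℕ.* p)) (λ d → cong (𝟙 (d ∣? m ℕ.* p) *_) (𝟙-split (p ∣? d) (F d))) ⟨
  ∑[ d ∣ m ℕ.* p ] (𝟙 (p ∣? d) * F d + 𝟙 (¬? (p ∣? d)) * F d)
    ≡⟨ ∑∣-distrib-+ (m ℕ.* p) (λ d → 𝟙 (p ∣? d) * F d) (λ d → 𝟙 (¬? (p ∣? d)) * F d) ⟩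
  ∑[ d ∣ m ℕ.* p ] (𝟙 (p ∣? d) * F d) + ∑[ d ∣ m ℕ.* p ] (𝟙 (¬? (p ∣? d)) * F d)
    ≡⟨ cong₂ _+_ (∑∣-multiples m p F) coprime-to-p ⟩
  ∑[ s ∣ m ] F (s ℕ.* p) + ∑[ s ∣ m ] (𝟙 (¬? (p ∣? s)) * F s)
    ≡⟨ ∑∣-distrib-+ m (λ s → F (s ℕ.* p)) (λ s → 𝟙 (¬? (p ∣? s)) * F s) ⟨
  ∑[ s ∣ m ] (F (s ℕ.* p) + 𝟙 (¬? (p ∣? s)) * F s) ∎
  where
  open ≡-Reasoning
  instance
    p≢0 : NonZero p
    p≢0 = prime⇒nonZero prime-p
    mp≢0 : NonZero (m ℕ.* p)
    mp≢0 = ℕ.m*n≢0 m p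
  same-term : ∀ d → 𝟙 (d ∣? m ℕ.* p) * (𝟙 (¬? (p ∣? d)) * F d) ≡ 𝟙 (d ∣? m) * (𝟙 (¬? (p ∣? d)) * F d)
  same-term d with p ∣? d
  ... | yes _   = trans (ℤ.*-zeroʳ (𝟙 (d ∣? m ℕ.* p))) (sym (ℤ.*-zeroʳ (𝟙 (d ∣? m))))
  ... | no  p∤d = cong (_* (+ 1 * F d)) (𝟙-⇔ (d ∣? m ℕ.* p) (d ∣? m) (mk⇔
    (λ d∣mp → coprime-divisor (Coprime.sym (prime∤⇒coprime prime-p p∤d)) (subst (d ∣_) (ℕ.*-comm m p) d∣mp))
    (∣m⇒∣m*n p)))
  coprime-to-p : ∑[ d ∣ m ℕ.* p ] (𝟙 (¬? (p ∣? d)) * F d) ≡ ∑[ d ∣ m ] (𝟙 (¬? (p ∣? d)) * F d)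
  coprime-to-p = trans (∑-cong (suc (m ℕ.* p)) same-term)
                       (sym (∑∣-extend {λ d → 𝟙 (¬? (p ∣? d)) * F d} m (m ℕ.* p) (ℕ.m≤m*n m p)))

sumℤ : List ℤ → ℤ
sumℤ = foldr _+_ (+ 0)

sumℤ-++ : ∀ (xs ys : List ℤ) → sumℤ (xs ++ ys) ≡ sumℤ xs + sumℤ ys
sumℤ-++ []       ys = sym (ℤ.+-identityˡ (sumℤ ys))
sumℤ-++ (x ∷ xs) ys = trans (cong (_+_ x) (sumℤ-++ xs ys)) (sym (ℤ.+-assoc x (sumℤ xs) (sumℤ ys)))

sumℤ-concatMap : ∀ (F : B → ℤ) (h : A → List B) xs →
                 sumℤ (map F (concatMap h xs)) ≡ sumℤ (map (λ x → sumℤ (map F (h x))) xs)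
sumℤ-concatMap F h []       = refl
sumℤ-concatMap F h (x ∷ xs) = begin
  sumℤ (map F (h x ++ concatMap h xs))                           ≡⟨ cong sumℤ (map-++ F (h x) (concatMap h xs)) ⟩
  sumℤ (map F (h x) ++ map F (concatMap h xs))                   ≡⟨ sumℤ-++ (map F (h x)) (map F (concatMap h xs)) ⟩
  sumℤ (map F (h x)) + sumℤ (map F (concatMap h xs))             ≡⟨ cong (_+_ (sumℤ (map F (h x)))) (sumℤ-concatMap F h xs) ⟩
  sumℤ (map F (h x)) + sumℤ (map (λ x → sumℤ (map F (h x))) xs)  ∎
  where open ≡-Reasoning

*-distribˡ-sumℤ : ∀ c (F : A → ℤ) xs → c * sumℤ (map F xs) ≡ sumℤ (map (λ x → c * F x) xs)
*-distribˡ-sumℤ c F []       = ℤ.*-zeroʳ c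
*-distribˡ-sumℤ c F (x ∷ xs) = trans (ℤ.*-distribˡ-+ c (F x) _) (cong (_+_ (c * F x)) (*-distribˡ-sumℤ c F xs))

sumℤ-∑-comm : ∀ n (F : A → ℕ → ℤ) xs →
              sumℤ (map (λ x → ∑[ i < n ] F x i) xs) ≡ ∑[ i < n ] sumℤ (map (λ x → F x i) xs)
sumℤ-∑-comm n F []       = sym (∑-vanishing n λ _ _ → refl)
sumℤ-∑-comm n F (x ∷ xs) = trans (cong (_+_ (∑[ i < n ] F x i)) (sumℤ-∑-comm n F xs))
                                 (sym (∑-distrib-+ n (F x) (λ i → sumℤ (map (λ y → F y i) xs))))

sumℤ-filter : ∀ {Pred : A → Set ℓ₂} (P? : Decidable Pred) (F : A → ℤ) xs →
              sumℤ (map F (filter P? xs)) ≡ sumℤ (map (λ x → 𝟙 (P? x) * F x) xs)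
sumℤ-filter P? F []       = refl
sumℤ-filter P? F (x ∷ xs) with P? x
... | yes _ = cong₂ _+_ (sym (ℤ.*-identityˡ (F x))) (sumℤ-filter P? F xs)
... | no  _ = trans (sumℤ-filter P? F xs) (sym (ℤ.+-identityˡ _))

+length≡sumℤ : ∀ (xs : List A) → + length xs ≡ sumℤ (map (λ _ → + 1) xs)
+length≡sumℤ []       = refl
+length≡sumℤ (x ∷ xs) = trans (ℤ.pos-+ 1 (length xs)) (cong (_+_ (+ 1)) (+length≡sumℤ xs))

sumℤ-applyUpTo : ∀ (F : ℕ → ℤ) f n → sumℤ (map F (applyUpTo f n)) ≡ ∑[ i < n ] F (f i)
sumℤ-applyUpTo F f zero    = refl
sumℤ-applyUpTo F f (suc n) = cong (_+_ (F (f 0))) (sumℤ-applyUpTo F (f ∘ suc) n)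

sumℤ-divisors : ∀ n .{{_ : NonZero n}} F → sumℤ (map F (divisors n)) ≡ ∑[ d ∣ n ] F d
sumℤ-divisors n F = begin
  sumℤ (map F (filter (_∣? n) (applyUpTo suc n)))          ≡⟨ sumℤ-filter (_∣? n) F (applyUpTo suc n) ⟩
  sumℤ (map (λ d → 𝟙 (d ∣? n) * F d) (applyUpTo suc n))   ≡⟨ sumℤ-applyUpTo _ suc n ⟩
  ∑[ i < n ] (𝟙 (suc i ∣? n) * F (suc i))                  ≡⟨ ℤ.+-identityˡ _ ⟨
  + 0 + ∑[ i < n ] (𝟙 (suc i ∣? n) * F (suc i))
    ≡⟨ cong (λ z → z * F 0 + ∑[ i < n ] (𝟙 (suc i ∣? n) * F (suc i))) (𝟙-no (0 ∣? n) 0∤n) ⟨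
  ∑[ d ∣ n ] F d                                           ∎
  where
  open ≡-Reasoning
  0∤n : ¬ 0 ∣ n
  0∤n 0∣n = ℕ.≢-nonZero⁻¹ n (0∣⇒≡0 0∣n)

-- The Möbius function

ω≡∑ : ∀ n .{{_ : NonZero n}} → + ω n ≡ ∑[ d ∣ n ] 𝟙 (prime? d)
ω≡∑ n = begin
  + length (filter prime? (divisors n))                       ≡⟨ +length≡sumℤ (filter prime? (divisors n)) ⟩
  sumℤ (map (λ _ → + 1) (filter prime? (divisors n)))         ≡⟨ sumℤ-filter prime? _ (divisors n) ⟩
  sumℤ (map (λ d → 𝟙 (prime? d) * + 1) (divisors n))          ≡⟨ sumℤ-divisors n _ ⟩
  ∑[ d ∣ n ] (𝟙 (prime? d) * + 1)
    ≡⟨ ∑-cong (suc n) (λ d → cong (𝟙 (d ∣? n) *_) (ℤ.*-identityʳ (𝟙 (prime? d)))) ⟩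
  ∑[ d ∣ n ] 𝟙 (prime? d)                                     ∎
  where open ≡-Reasoning

module _ {p s : ℕ} (prime-p : Prime p) (p∤s : ¬ p ∣ s) .{{_ : NonZero s}} where

  private instance
    p≢0 : NonZero p
    p≢0 = prime⇒nonZero prime-p

  ω[p*s]≡1+ω[s] : ω (p ℕ.* s) ≡ suc (ω s)
  ω[p*s]≡1+ω[s] = ℤ.+-injective (begin
    + ω (p ℕ.* s)                                                       ≡⟨ ω≡∑ (p ℕ.* s) {{ℕ.m*n≢0 p s}} ⟩
    ∑[ d ∣ p ℕ.* s ] 𝟙 (prime? d)                                       ≡⟨ ∑-cong (suc (p ℕ.* s)) prime-divisors ⟩
    ∑[ d < suc (p ℕ.* s) ] (𝟙 (d ∣? s) * 𝟙 (prime? d) + 𝟙 (d ≟ p))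
      ≡⟨ ∑-distrib-+ (suc (p ℕ.* s)) (λ d → 𝟙 (d ∣? s) * 𝟙 (prime? d)) (λ d → 𝟙 (d ≟ p)) ⟩
    ∑[ d < suc (p ℕ.* s) ] (𝟙 (d ∣? s) * 𝟙 (prime? d)) + ∑[ d < suc (p ℕ.* s) ] 𝟙 (d ≟ p)
      ≡⟨ cong₂ _+_ (sym (∑∣-extend {λ d → 𝟙 (prime? d)} s (p ℕ.* s) (ℕ.m≤n*m s p))) only-p ⟩
    ∑[ d ∣ s ] 𝟙 (prime? d) + + 1                                       ≡⟨ cong (_+ + 1) (ω≡∑ s) ⟨
    + ω s + + 1                                                         ≡⟨ ℤ.+-comm (+ ω s) (+ 1) ⟩
    + suc (ω s)                                                         ∎)
    where
    open ≡-Reasoning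
    prime-divisors : ∀ d → 𝟙 (d ∣? p ℕ.* s) * 𝟙 (prime? d) ≡ 𝟙 (d ∣? s) * 𝟙 (prime? d) + 𝟙 (d ≟ p)
    prime-divisors d with d ≟ p
    ... | yes refl rewrite 𝟙-yes (p ∣? p ℕ.* s) (m∣m*n s) | 𝟙-yes (prime? p) prime-p | 𝟙-no (p ∣? s) p∤s = refl
    ... | no d≢p with prime? d
    ...   | no  _       = trans (ℤ.*-zeroʳ (𝟙 (d ∣? p ℕ.* s)))
                                (sym (trans (ℤ.+-identityʳ _) (ℤ.*-zeroʳ (𝟙 (d ∣? s)))))
    ...   | yes prime-d = trans (cong (_* + 1) (𝟙-⇔ (d ∣? p ℕ.* s) (d ∣? s)
                                  (mk⇔ (prime-divisor-of-p*s prime-p prime-d d≢p) (∣n⇒∣m*n p))))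
                                (sym (ℤ.+-identityʳ _))
    only-p : ∑[ d < suc (p ℕ.* s) ] 𝟙 (d ≟ p) ≡ + 1
    only-p = trans (∑-single (suc (p ℕ.* s)) p (s≤s (ℕ.m≤m*n p s)) λ d _ d≢p → 𝟙-no (d ≟ p) d≢p)
                   (𝟙-yes (p ≟ p) refl)

  hasSquareDivisor[p*s]⇔ : HasSquareDivisor (p ℕ.* s) ⇔ HasSquareDivisor s
  hasSquareDivisor[p*s]⇔ = mk⇔
    (λ (d , 2≤d , dd∣ps) → d , 2≤d , square-divisor-of-p*s {d = d} prime-p p∤s dd∣ps)
    (λ (d , 2≤d , dd∣s)  → d , 2≤d , ∣n⇒∣m*n p dd∣s)

  μ[p*s]≡-μ[s] : μ (p ℕ.* s) ≡ - μ s
  μ[p*s]≡-μ[s] rewrite squarefree-cong (p ℕ.* s) s {{ℕ.m*n≢0 p s}} hasSquareDivisor[p*s]⇔ | ω[p*s]≡1+ω[s] with squarefree s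
  ... | true  = ℤ.-1*i≡-i _
  ... | false = refl

μ[p*s]≡0 : ∀ {p s} → Prime p → p ∣ s → .{{_ : NonZero s}} → μ (p ℕ.* s) ≡ + 0
μ[p*s]≡0 {p} {s} prime-p p∣s
  rewrite Equivalence.from (squarefree≡false⇔ (p ℕ.* s) {{ℕ.m*n≢0 p s {{prime⇒nonZero prime-p}}}})
            (p , ℕ.nonTrivial⇒n>1 p {{prime⇒nonTrivial prime-p}} , *-monoʳ-∣ p p∣s) = refl

∑∣-μ[m*p]≡0 : ∀ {p} m → Prime p → .{{_ : NonZero m}} → ∑[ d ∣ m ℕ.* p ] μ d ≡ + 0
∑∣-μ[m*p]≡0 {p} m prime-p = begin
  ∑[ d ∣ m ℕ.* p ] μ d                                ≡⟨ ∑∣-split-prime m prime-p μ ⟩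
  ∑[ s ∣ m ] (μ (s ℕ.* p) + 𝟙 (¬? (p ∣? s)) * μ s)     ≡⟨ ∑∣-cong m cancel ⟩
  ∑[ s ∣ m ] (+ 0)                                    ≡⟨ ∑-vanishing (suc m) (λ s _ → ℤ.*-zeroʳ (𝟙 (s ∣? m))) ⟩
  + 0                                                 ∎
  where
  open ≡-Reasoning
  cancel : ∀ s → s ∣ m → μ (s ℕ.* p) + 𝟙 (¬? (p ∣? s)) * μ s ≡ + 0
  cancel s s∣m with p ∣? s
  ... | yes p∣s = trans (ℤ.+-identityʳ (μ (s ℕ.* p)))
                        (trans (cong μ (ℕ.*-comm s p)) (μ[p*s]≡0 prime-p p∣s {{∣⇒nonZero s∣m}}))
  ... | no  p∤s = begin
    μ (s ℕ.* p) + + 1 * μ s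
      ≡⟨ cong₂ _+_ (trans (cong μ (ℕ.*-comm s p)) (μ[p*s]≡-μ[s] prime-p p∤s {{∣⇒nonZero s∣m}})) (ℤ.*-identityˡ (μ s)) ⟩
    - μ s + μ s              ≡⟨ ℤ.+-inverseˡ (μ s) ⟩
    + 0                      ∎

∑∣-μ : ∀ n .{{_ : NonZero n}} → ∑[ d ∣ n ] μ d ≡ 𝟙 (n ≟ 1)
∑∣-μ 1 = refl
∑∣-μ n@(suc (suc _)) with ∃-prime-divisor n (s≤s (s≤s z≤n))
... | p , prime-p , divides m n≡mp = begin
  ∑[ d ∣ n ] μ d        ≡⟨ cong (λ k → ∑[ d ∣ k ] μ d) n≡mp ⟩
  ∑[ d ∣ m ℕ.* p ] μ d  ≡⟨ ∑∣-μ[m*p]≡0 m prime-p {{ℕ.m*n≢0⇒m≢0 m {{subst NonZero n≡mp it}}}} ⟩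
  + 0                   ≡⟨ 𝟙-no (n ≟ 1) (λ ()) ⟨
  𝟙 (n ≟ 1)             ∎
  where open ≡-Reasoning

private
  ∑-factor-pairs : ∀ n .{{_ : NonZero n}} a (F : ℕ → ℤ) →
                   ∑[ b < suc n ] (𝟙 (a ℕ.* b ≟ n) * F b) ≡ 𝟙 (a ∣? n) * F (n div a)
  ∑-factor-pairs n a F with a ∣? n
  ... | no a∤n = ∑-vanishing (suc n) λ b _ →
    cong (_* F b) (𝟙-no (a ℕ.* b ≟ n) λ ab≡n → a∤n (divides b (trans (sym ab≡n) (ℕ.*-comm a b))))
  ... | yes (divides q n≡qa) = begin
    ∑[ b < suc n ] (𝟙 (a ℕ.* b ≟ n) * F b)  ≡⟨ ∑-single (suc n) q (s≤s q≤n) others≡0 ⟩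
    𝟙 (a ℕ.* q ≟ n) * F q                   ≡⟨ cong₂ _*_ (𝟙-yes (a ℕ.* q ≟ n) aq≡n) (cong F (sym n-div-a≡q)) ⟩
    + 1 * F (n div a)                       ∎
    where
    open ≡-Reasoning
    instance
      a≢0 : NonZero a
      a≢0 = ℕ.m*n≢0⇒n≢0 q {{subst NonZero n≡qa it}}
    aq≡n : a ℕ.* q ≡ n
    aq≡n = trans (ℕ.*-comm a q) (sym n≡qa)
    n-div-a≡q : n div a ≡ q
    n-div-a≡q = trans (cong (_div a) n≡qa) (m*n-div-n≡m q a)
    q≤n : q ℕ.≤ n
    q≤n = subst (q ℕ.≤_) (sym n≡qa) (ℕ.m≤m*n q a)
    others≡0 : ∀ b → b < suc n → b ≢ q → 𝟙 (a ℕ.* b ≟ n) * F b ≡ + 0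
    others≡0 b _ b≢q = cong (_* F b) (𝟙-no (a ℕ.* b ≟ n) λ ab≡n → b≢q (ℕ.*-cancelˡ-≡ b q a (trans ab≡n (sym aq≡n))))

∑∣-complement : ∀ n .{{_ : NonZero n}} (F : ℕ → ℤ) → ∑[ d ∣ n ] F (n div d) ≡ ∑[ d ∣ n ] F d
∑∣-complement n F = begin
  ∑[ a ∣ n ] F (n div a)                                         ≡⟨ ∑-cong (suc n) (λ a → ∑-factor-pairs n a F) ⟨
  ∑[ a < suc n ] (∑[ b < suc n ] (𝟙 (a ℕ.* b ≟ n) * F b))
    ≡⟨ ∑-comm (suc n) (suc n) (λ a b → 𝟙 (a ℕ.* b ≟ n) * F b) ⟩
  ∑[ b < suc n ] (∑[ a < suc n ] (𝟙 (a ℕ.* b ≟ n) * F b))      ≡⟨ ∑-cong (suc n) pairs-with-b ⟩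
  ∑[ b ∣ n ] F b                                                  ∎
  where
  open ≡-Reasoning
  pairs-with-b : ∀ b → ∑[ a < suc n ] (𝟙 (a ℕ.* b ≟ n) * F b) ≡ 𝟙 (b ∣? n) * F b
  pairs-with-b b = trans (∑-cong (suc n) λ a → cong (λ k → 𝟙 (k ≟ n) * F b) (ℕ.*-comm a b))
                         (∑-factor-pairs n b (λ _ → F b))

∑∣-μ-interval : ∀ n e .{{_ : NonZero n}} .{{_ : NonZero e}} → ∑[ d ∣ n ] (μ (n div d) * 𝟙 (e ∣? d)) ≡ 𝟙 (e ≟ n)
∑∣-μ-interval n e with e ∣? n
... | no e∤n = trans (∑-vanishing (suc n) terms≡0) (sym (𝟙-no (e ≟ n) (e∤n ∘ ∣-reflexive)))
  where
  terms≡0 : ∀ d → d < suc n → 𝟙 (d ∣? n) * (μ (n div d) * 𝟙 (e ∣? d)) ≡ + 0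
  terms≡0 d _ with d ∣? n
  ... | no  _   = refl
  ... | yes d∣n = trans (cong (λ z → + 1 * (μ (n div d) * z)) (𝟙-no (e ∣? d) λ e∣d → e∤n (∣-trans e∣d d∣n)))
                        (cong (+ 1 *_) (ℤ.*-zeroʳ (μ (n div d))))
... | yes (divides t refl) = begin
  ∑[ d ∣ t ℕ.* e ] (μ ((t ℕ.* e) div d) * 𝟙 (e ∣? d))
    ≡⟨ ∑-cong (suc (t ℕ.* e)) (λ d → cong (𝟙 (d ∣? t ℕ.* e) *_) (ℤ.*-comm (μ ((t ℕ.* e) div d)) (𝟙 (e ∣? d)))) ⟩
  ∑[ d ∣ t ℕ.* e ] (𝟙 (e ∣? d) * μ ((t ℕ.* e) div d))  ≡⟨ ∑∣-multiples t e (λ d → μ ((t ℕ.* e) div d)) ⟩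
  ∑[ s ∣ t ] μ ((t ℕ.* e) div (s ℕ.* e))               ≡⟨ ∑∣-cong t (λ s s∣t → cong μ (cancel-e s∣t)) ⟩
  ∑[ s ∣ t ] μ (t div s)                               ≡⟨ ∑∣-complement t μ ⟩
  ∑[ s ∣ t ] μ s                                       ≡⟨ ∑∣-μ t ⟩
  𝟙 (t ≟ 1)                                            ≡⟨ 𝟙-⇔ (t ≟ 1) (e ≟ t ℕ.* e) t≡1⇔e≡te ⟩
  𝟙 (e ≟ t ℕ.* e)                                      ∎
  where
  open ≡-Reasoning
  instance
    t≢0 : NonZero t
    t≢0 = ℕ.m*n≢0⇒m≢0 t
  cancel-e : ∀ {s} → s ∣ t → (t ℕ.* e) div (s ℕ.* e) ≡ t div s
  cancel-e {s} (divides r t≡rs) = trans (m≡q*n⇒m-div-n≡q r (s ℕ.* e) te≡r*se) (sym (m≡q*n⇒m-div-n≡q r s t≡rs))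
    where
    instance
      s≢0 : NonZero s
      s≢0 = ∣⇒nonZero (divides r t≡rs)
      se≢0 : NonZero (s ℕ.* e)
      se≢0 = ℕ.m*n≢0 s e
    te≡r*se : t ℕ.* e ≡ r ℕ.* (s ℕ.* e)
    te≡r*se = trans (cong (ℕ._* e) t≡rs) (ℕ.*-assoc r s e)
  t≡1⇔e≡te : t ≡ 1 ⇔ e ≡ t ℕ.* e
  t≡1⇔e≡te = mk⇔ (λ t≡1 → sym (trans (cong (ℕ._* e) t≡1) (ℕ.*-identityˡ e)))
                 (λ e≡te → ℕ.*-cancelʳ-≡ t 1 e (trans (sym e≡te) (sym (ℕ.*-identityˡ e))))

-- Möbius inversion over fractions

module _ {M p n : ℕ} .{{_ : NonZero M}} (M≡pn : M ≡ p ℕ.* n) where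

  private instance
    n≢0 : NonZero n
    n≢0 = ℕ.m*n≢0⇒n≢0 p {{subst NonZero M≡pn it}}

  ∑∣-μ-denominator : ∀ x → ∑[ d ∣ n ] (μ (n div d) * 𝟙 (M div d ∣? x)) ≡ 𝟙 (p ∣? x) * 𝟙 (coprime? (x div p) n)
  ∑∣-μ-denominator x = begin
    ∑[ d ∣ n ] (μ (n div d) * 𝟙 (M div d ∣? x))  ≡⟨ ∑∣-cong n via-denominator ⟩
    ∑[ d ∣ n ] (μ (n div d) * 𝟙 (e ∣? d))        ≡⟨ ∑∣-μ-interval n e ⟩
    𝟙 (e ≟ n)                                    ≡⟨ 𝟙-× (p ∣? x) (coprime? (x div p) n) (e ≟ n) (denominator≡⇔ {x} M≡pn) ⟨
    𝟙 (p ∣? x) * 𝟙 (coprime? (x div p) n)        ∎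
    where
    open ≡-Reasoning
    e = denominator x M
    instance
      e≢0 : NonZero e
      e≢0 = denominator≢0 {x} {M}
    via-denominator : ∀ d → d ∣ n → μ (n div d) * 𝟙 (M div d ∣? x) ≡ μ (n div d) * 𝟙 (e ∣? d)
    via-denominator d d∣n = cong (μ (n div d) *_)
      (𝟙-⇔ (M div d ∣? x) (e ∣? d) (denominator-∣⇔ {x} (sym (m-div-n*n≡m {{∣⇒nonZero d∣M}} d∣M))))
      where
      d∣M : d ∣ M
      d∣M = ∣-trans d∣n (divides p M≡pn)

  ∑∣-μ-fractions : ∀ (Φ : ℕ → ℤ) →
    ∑[ d ∣ n ] (μ (n div d) * ∑[ a < d ] Φ (a ℕ.* (M div d))) ≡ ∑[ a < n ] (𝟙 (coprime? a n) * Φ (a ℕ.* p))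
  ∑∣-μ-fractions Φ = begin
    ∑[ d ∣ n ] (μ (n div d) * ∑[ a < d ] Φ (a ℕ.* (M div d)))
      ≡⟨ ∑∣-cong n as-multiples ⟩
    ∑[ d ∣ n ] (∑[ x < M ] (μ (n div d) * (𝟙 (M div d ∣? x) * Φ x)))
      ≡⟨ ∑∣-comm n M (λ d x → μ (n div d) * (𝟙 (M div d ∣? x) * Φ x)) ⟩
    ∑[ x < M ] (∑[ d ∣ n ] (μ (n div d) * (𝟙 (M div d ∣? x) * Φ x)))
      ≡⟨ ∑-cong M inner ⟩
    ∑[ x < M ] (𝟙 (p ∣? x) * (𝟙 (coprime? (x div p) n) * Φ x))
      ≡⟨ cong (λ k → ∑< k (λ x → 𝟙 (p ∣? x) * (𝟙 (coprime? (x div p) n) * Φ x))) (trans M≡pn (ℕ.*-comm p n)) ⟩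
    ∑[ x < n ℕ.* p ] (𝟙 (p ∣? x) * (𝟙 (coprime? (x div p) n) * Φ x))
      ≡⟨ ∑-multiples p n (λ x → 𝟙 (coprime? (x div p) n) * Φ x) ⟨
    ∑[ a < n ] (𝟙 (coprime? ((a ℕ.* p) div p) n) * Φ (a ℕ.* p))
      ≡⟨ ∑-cong n (λ a → cong (λ k → 𝟙 (coprime? k n) * Φ (a ℕ.* p)) (m*n-div-n≡m a p)) ⟩
    ∑[ a < n ] (𝟙 (coprime? a n) * Φ (a ℕ.* p))  ∎
    where
    open ≡-Reasoning
    instance
      p≢0 : NonZero p
      p≢0 = ℕ.m*n≢0⇒m≢0 p {{subst NonZero M≡pn it}}
    as-multiples : ∀ d → d ∣ n →
      μ (n div d) * ∑[ a < d ] Φ (a ℕ.* (M div d)) ≡ ∑[ x < M ] (μ (n div d) * (𝟙 (M div d ∣? x) * Φ x))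
    as-multiples d d∣n = trans (cong (μ (n div d) *_) (∑-as-multiples (∣-trans d∣n (divides p M≡pn)) Φ))
                               (*-distribˡ-∑ M (μ (n div d)) (λ x → 𝟙 (M div d ∣? x) * Φ x))
    inner : ∀ x → ∑[ d ∣ n ] (μ (n div d) * (𝟙 (M div d ∣? x) * Φ x)) ≡ 𝟙 (p ∣? x) * (𝟙 (coprime? (x div p) n) * Φ x)
    inner x = begin
      ∑[ d ∣ n ] (μ (n div d) * (𝟙 (M div d ∣? x) * Φ x))
        ≡⟨ ∑-cong (suc n) (λ d → cong (𝟙 (d ∣? n) *_) (ℤ.*-assoc (μ (n div d)) (𝟙 (M div d ∣? x)) (Φ x))) ⟨
      ∑[ d ∣ n ] (μ (n div d) * 𝟙 (M div d ∣? x) * Φ x)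
        ≡⟨ *-distribʳ-∑∣ n (Φ x) (λ d → μ (n div d) * 𝟙 (M div d ∣? x)) ⟨
      ∑[ d ∣ n ] (μ (n div d) * 𝟙 (M div d ∣? x)) * Φ x    ≡⟨ cong (_* Φ x) (∑∣-μ-denominator x) ⟩
      𝟙 (p ∣? x) * 𝟙 (coprime? (x div p) n) * Φ x          ≡⟨ ℤ.*-assoc (𝟙 (p ∣? x)) (𝟙 (coprime? (x div p) n)) (Φ x) ⟩
      𝟙 (p ∣? x) * (𝟙 (coprime? (x div p) n) * Φ x)        ∎

-- Linear congruences

∑-unique-solution : ∀ n .{{_ : NonZero n}} w r → Coprime n w → ∑[ a < n ] 𝟙 (n ∣? r ℕ.+ a ℕ.* w) ≡ + 1
∑-unique-solution n w r coprime with congruence-solvable n w r coprime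
... | b , b<n , n∣r+bw = trans (∑-single n b b<n others≡0) (𝟙-yes (n ∣? r ℕ.+ b ℕ.* w) n∣r+bw)
  where
  others≡0 : ∀ a → a < n → a ≢ b → 𝟙 (n ∣? r ℕ.+ a ℕ.* w) ≡ + 0
  others≡0 a a<n a≢b = 𝟙-no (n ∣? r ℕ.+ a ℕ.* w) λ n∣r+aw → a≢b (congruence-unique coprime a<n b<n n∣r+aw n∣r+bw)

∑-congruence : ∀ g P .{{_ : NonZero g}} .{{_ : NonZero P}} w q r → Coprime P w →
               ∑[ a < q ℕ.* P ] 𝟙 (g ℕ.* P ∣? r ℕ.+ a ℕ.* (g ℕ.* w)) ≡ 𝟙 (g ∣? r) * + q
∑-congruence g P w q r coprime with g ∣? r
... | no g∤r = ∑-vanishing (q ℕ.* P) λ a _ → 𝟙-no (g ℕ.* P ∣? r ℕ.+ a ℕ.* (g ℕ.* w)) λ gP∣ →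
  g∤r (∣m+n∣m⇒∣n (subst (g ∣_) (ℕ.+-comm r _) (∣-trans (m∣m*n P) gP∣)) (∣n⇒∣m*n a (m∣m*n w)))
... | yes (divides r′ refl) = begin
  ∑[ a < q ℕ.* P ] 𝟙 (g ℕ.* P ∣? r′ ℕ.* g ℕ.+ a ℕ.* (g ℕ.* w)) ≡⟨ ∑-cong (q ℕ.* P) cancel-g ⟩
  ∑[ a < q ℕ.* P ] 𝟙 (P ∣? r′ ℕ.+ a ℕ.* w)                     ≡⟨ ∑-periodic P q _ periodic ⟩
  + q * ∑[ a < P ] 𝟙 (P ∣? r′ ℕ.+ a ℕ.* w)                     ≡⟨ cong (+ q *_) (∑-unique-solution P w r′ coprime) ⟩
  + q * + 1                                                     ≡⟨ ℤ.*-comm (+ q) (+ 1) ⟩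
  + 1 * + q                                                     ∎
  where
  open ≡-Reasoning
  factor : ∀ r′ g a w → r′ ℕ.* g ℕ.+ a ℕ.* (g ℕ.* w) ≡ g ℕ.* (r′ ℕ.+ a ℕ.* w)
  factor = solve-∀
  shift : ∀ r′ P a w → r′ ℕ.+ (P ℕ.+ a) ℕ.* w ≡ P ℕ.* w ℕ.+ (r′ ℕ.+ a ℕ.* w)
  shift = solve-∀
  cancel-g : ∀ a → 𝟙 (g ℕ.* P ∣? r′ ℕ.* g ℕ.+ a ℕ.* (g ℕ.* w)) ≡ 𝟙 (P ∣? r′ ℕ.+ a ℕ.* w)
  cancel-g a = 𝟙-⇔ _ _ (subst (λ k → (g ℕ.* P ∣ k) ⇔ (P ∣ r′ ℕ.+ a ℕ.* w)) (sym (factor r′ g a w))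
                              (mk⇔ (*-cancelˡ-∣ g) (*-monoʳ-∣ g)))
  periodic : ∀ a → 𝟙 (P ∣? r′ ℕ.+ (P ℕ.+ a) ℕ.* w) ≡ 𝟙 (P ∣? r′ ℕ.+ a ℕ.* w)
  periodic a = 𝟙-⇔ _ _ (subst (λ k → (P ∣ k) ⇔ (P ∣ r′ ℕ.+ a ℕ.* w)) (sym (shift r′ P a w))
                              (mk⇔ (λ P∣ → ∣m+n∣m⇒∣n P∣ (m∣m*n w)) (∣m∣n⇒∣m+n (m∣m*n w))))

∑-divisor-congruence : ∀ {M d L} .{{_ : NonZero M}} r → d ∣ M → L ∣ M →
  ∑[ x < d ] 𝟙 (M div L ∣? r ℕ.+ x ℕ.* (M div d)) ≡ 𝟙 (M div lcm d L ∣? r) * + gcd d L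
∑-divisor-congruence {M} {d} {L} r d∣M L∣M
  with gcd[m,n]∣m (M div d) (M div L) | gcd[m,n]∣n (M div d) (M div L)
... | divides w a≡wg | divides P b≡Pg = begin
  ∑[ x < d ] 𝟙 (b ∣? r ℕ.+ x ℕ.* a)
    ≡⟨ cong₂ (λ k l → ∑[ x < d ] 𝟙 (k ∣? r ℕ.+ x ℕ.* l)) b≡gP a≡gw ⟩
  ∑[ x < d ] 𝟙 (g ℕ.* P ∣? r ℕ.+ x ℕ.* (g ℕ.* w))
    ≡⟨ cong (λ k → ∑[ x < k ] 𝟙 (g ℕ.* P ∣? r ℕ.+ x ℕ.* (g ℕ.* w))) d≡gcd*P ⟩
  ∑[ x < gcd d L ℕ.* P ] 𝟙 (g ℕ.* P ∣? r ℕ.+ x ℕ.* (g ℕ.* w))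
    ≡⟨ ∑-congruence g P w (gcd d L) r (Coprime.sym coprime) ⟩
  𝟙 (g ∣? r) * + gcd d L
    ≡⟨ cong (λ k → 𝟙 (k ∣? r) * + gcd d L) M/lcm≡g ⟨
  𝟙 (M div lcm d L ∣? r) * + gcd d L ∎
  where
  open ≡-Reasoning
  a = M div d
  b = M div L
  g = gcd a b
  instance
    d≢0 : NonZero d
    d≢0 = ∣⇒nonZero d∣M
    L≢0 : NonZero L
    L≢0 = ∣⇒nonZero L∣M
    b≢0 : NonZero b
    b≢0 = m-div-n≢0 L∣M
    g≢0 : NonZero g
    g≢0 = ℕ.≢-nonZero (gcd[m,n]≢0 a b (inj₂ (ℕ.≢-nonZero⁻¹ b)))
    P≢0 : NonZero P
    P≢0 = ℕ.m*n≢0⇒m≢0 P {{subst NonZero b≡Pg it}}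
  ad≡bL : a ℕ.* d ≡ b ℕ.* L
  ad≡bL = trans (m-div-n*n≡m d∣M) (sym (m-div-n*n≡m L∣M))
  coprime : Coprime w P
  coprime = subst₂ Coprime (trans (sym (div≡/ a g)) (m≡q*n⇒m-div-n≡q w g a≡wg))
                           (trans (sym (div≡/ b g)) (m≡q*n⇒m-div-n≡q P g b≡Pg))
                           (coprime-/gcd a b)
  a≡gw : a ≡ g ℕ.* w
  a≡gw = trans a≡wg (ℕ.*-comm w g)
  b≡gP : b ≡ g ℕ.* P
  b≡gP = trans b≡Pg (ℕ.*-comm P g)
  d≡gcd*P : d ≡ gcd d L ℕ.* P
  d≡gcd*P = ℕ.*-cancelʳ-≡ d (gcd d L ℕ.* P) g (begin
    d ℕ.* g                ≡⟨ m*gcd[u,v]≡gcd[m,n]*v a b d L ad≡bL ⟩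
    gcd d L ℕ.* b          ≡⟨ cong (gcd d L ℕ.*_) b≡Pg ⟩
    gcd d L ℕ.* (P ℕ.* g)  ≡⟨ ℕ.*-assoc (gcd d L) P g ⟨
    gcd d L ℕ.* P ℕ.* g    ∎)
  M/lcm≡g : M div lcm d L ≡ g
  M/lcm≡g = m≡q*n⇒m-div-n≡q g (lcm d L) {{∣⇒nonZero (lcm-least d∣M L∣M)}} (begin
    M                    ≡⟨ m-div-n*n≡m d∣M ⟨
    a ℕ.* d              ≡⟨ lcm[m,n]*gcd[u,v]≡u*m a b d L ad≡bL ⟨
    lcm d L ℕ.* g        ≡⟨ ℕ.*-comm (lcm d L) g ⟩
    g ℕ.* lcm d L        ∎)

-- Counting tuples of fractions with integral sum

lcmL-least : ∀ {M ds} → ListAll.All (_∣ M) ds → lcmL ds ∣ M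
lcmL-least []             = 1∣ _
lcmL-least (d∣M ∷ ds∣M)   = lcm-least d∣M (lcmL-least ds∣M)

lcmL∣prodL : ∀ ds → lcmL ds ∣ prodL ds
lcmL∣prodL []       = ∣-refl
lcmL∣prodL (d ∷ ds) = lcm-least (m∣m*n {d} (prodL ds)) (∣n⇒∣m*n d (lcmL∣prodL ds))

-- solutions M ds r counts the tuples aᵢ < dᵢ with r/M + Σ aᵢ/dᵢ ∈ ℤ (for dᵢ ∣ M).
solutions : ℕ → List ℕ → ℕ → ℤ
solutions M []       r = 𝟙 (M ∣? r)
solutions M (d ∷ ds) r = ∑[ a < d ] solutions M ds (r ℕ.+ a ℕ.* (M div d))

solutions≡prod/lcm : ∀ M .{{_ : NonZero M}} {ds} → ListAll.All (_∣ M) ds → ∀ r →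
             solutions M ds r ≡ 𝟙 (M div lcmL ds ∣? r) * + (prodL ds div lcmL ds)
solutions≡prod/lcm M [] r = trans (sym (ℤ.*-identityʳ (𝟙 (M ∣? r))))
                                  (cong (λ k → 𝟙 (k ∣? r) * + 1) (sym (m≡q*n⇒m-div-n≡q M 1 (sym (ℕ.*-identityʳ M)))))
solutions≡prod/lcm M {d ∷ ds} (d∣M ∷ ds∣M) r with lcmL∣prodL ds
... | divides c prodL≡cL = begin
  ∑[ a < d ] solutions M ds (r ℕ.+ a ℕ.* (M div d))
    ≡⟨ ∑-cong d (λ a → solutions≡prod/lcm M ds∣M (r ℕ.+ a ℕ.* (M div d))) ⟩
  ∑[ a < d ] (𝟙 (M div L ∣? r ℕ.+ a ℕ.* (M div d)) * + (prodL ds div L))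
    ≡⟨ *-distribʳ-∑ d (+ (prodL ds div L)) _ ⟨
  ∑[ a < d ] 𝟙 (M div L ∣? r ℕ.+ a ℕ.* (M div d)) * + (prodL ds div L)
    ≡⟨ cong (_* + (prodL ds div L)) (∑-divisor-congruence r d∣M L∣M) ⟩
  𝟙 (M div lcm d L ∣? r) * + gcd d L * + (prodL ds div L)
    ≡⟨ ℤ.*-assoc (𝟙 (M div lcm d L ∣? r)) (+ gcd d L) _ ⟩
  𝟙 (M div lcm d L ∣? r) * (+ gcd d L * + (prodL ds div L))
    ≡⟨ cong (𝟙 (M div lcm d L ∣? r) *_) (sym (ℤ.pos-* (gcd d L) (prodL ds div L))) ⟩
  𝟙 (M div lcm d L ∣? r) * + (gcd d L ℕ.* (prodL ds div L))
    ≡⟨ cong (λ k → 𝟙 (M div lcm d L ∣? r) * + k) gcd*quotient ⟩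
  𝟙 (M div lcm d L ∣? r) * + ((d ℕ.* prodL ds) div lcm d L) ∎
  where
  open ≡-Reasoning
  L = lcmL ds
  L∣M : L ∣ M
  L∣M = lcmL-least ds∣M
  instance
    L≢0 : NonZero L
    L≢0 = ∣⇒nonZero L∣M
    lcm≢0 : NonZero (lcm d L)
    lcm≢0 = ∣⇒nonZero (lcm-least d∣M L∣M)
  gcd*quotient : gcd d L ℕ.* (prodL ds div L) ≡ (d ℕ.* prodL ds) div lcm d L
  gcd*quotient = begin
    gcd d L ℕ.* (prodL ds div L)        ≡⟨ cong (λ k → gcd d L ℕ.* (k div L)) prodL≡cL ⟩
    gcd d L ℕ.* ((c ℕ.* L) div L)       ≡⟨ cong (gcd d L ℕ.*_) (m*n-div-n≡m c L) ⟩
    gcd d L ℕ.* c                       ≡⟨ m*[c*n]-div-lcm≡gcd*c d L c ⟨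
    (d ℕ.* (c ℕ.* L)) div lcm d L       ≡⟨ cong (λ k → (d ℕ.* k) div lcm d L) prodL≡cL ⟨
    (d ℕ.* prodL ds) div lcm d L        ∎

coprimeSolutions : ℕ → ∀ {k} → Vec ℕ k → ℕ → ℤ
coprimeSolutions M []       r = 𝟙 (M ∣? r)
coprimeSolutions M (n ∷ ns) r = ∑[ a < n ] (𝟙 (coprime? a n) * coprimeSolutions M ns (r ℕ.+ a ℕ.* (M div n)))

0≤coprimeSolutions : ∀ M {k} (ns : Vec ℕ k) r → + 0 ≤ coprimeSolutions M ns r
0≤coprimeSolutions M []       r = 0≤𝟙 (M ∣? r)
0≤coprimeSolutions M (n ∷ ns) r = 0≤∑ n λ a → 0≤𝟙* (coprime? a n) (0≤coprimeSolutions M ns _)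

∑-μprod*solutions≡coprimeSolutions : ∀ M .{{_ : NonZero M}} {k} {ns : Vec ℕ k} → All (_∣ M) ns → ∀ r →
  sumℤ (map (λ ds → μprod ns ds * solutions M ds r) (divisorTuples ns)) ≡ coprimeSolutions M ns r
∑-μprod*solutions≡coprimeSolutions M [] r = trans (ℤ.+-identityʳ _) (ℤ.*-identityˡ _)
∑-μprod*solutions≡coprimeSolutions M {ns = n ∷ ns} (n∣M ∷ ns∣M) r = begin
  sumℤ (map summand (concatMap (λ d → map (d ∷_) (divisorTuples ns)) (divisors n)))
    ≡⟨ sumℤ-concatMap summand (λ d → map (d ∷_) (divisorTuples ns)) (divisors n) ⟩
  sumℤ (map (λ d → sumℤ (map summand (map (d ∷_) (divisorTuples ns)))) (divisors n))
    ≡⟨ cong sumℤ (map-cong first-divisor (divisors n)) ⟩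
  sumℤ (map (λ d → μ (n div d) * ∑[ a < d ] Φ (a ℕ.* (M div d))) (divisors n))
    ≡⟨ sumℤ-divisors n _ ⟩
  ∑[ d ∣ n ] (μ (n div d) * ∑[ a < d ] Φ (a ℕ.* (M div d)))
    ≡⟨ ∑∣-μ-fractions {M} {M div n} {n} (sym (m-div-n*n≡m n∣M)) Φ ⟩
  coprimeSolutions M (n ∷ ns) r ∎
  where
  open ≡-Reasoning
  instance
    n≢0 : NonZero n
    n≢0 = ∣⇒nonZero n∣M
  summand : List ℕ → ℤ
  summand ds = μprod (n ∷ ns) ds * solutions M ds r
  Φ : ℕ → ℤ
  Φ x = coprimeSolutions M ns (r ℕ.+ x)
  first-divisor : ∀ d → sumℤ (map summand (map (d ∷_) (divisorTuples ns))) ≡ μ (n div d) * ∑[ a < d ] Φ (a ℕ.* (M div d))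
  first-divisor d = begin
    sumℤ (map summand (map (d ∷_) (divisorTuples ns)))
      ≡⟨ cong sumℤ (map-∘ (divisorTuples ns)) ⟨
    sumℤ (map (λ ds → μ (n div d) * μprod ns ds * ∑[ a < d ] shifted ds a) (divisorTuples ns))
      ≡⟨ cong sumℤ (map-cong (λ ds → trans (ℤ.*-assoc (μ (n div d)) (μprod ns ds) _)
                                           (cong (μ (n div d) *_) (*-distribˡ-∑ d (μprod ns ds) (shifted ds))))
                             (divisorTuples ns)) ⟩
    sumℤ (map (λ ds → μ (n div d) * ∑[ a < d ] (μprod ns ds * shifted ds a)) (divisorTuples ns))
      ≡⟨ *-distribˡ-sumℤ (μ (n div d)) _ (divisorTuples ns) ⟨
    μ (n div d) * sumℤ (map (λ ds → ∑[ a < d ] (μprod ns ds * shifted ds a)) (divisorTuples ns))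
      ≡⟨ cong (μ (n div d) *_) (sumℤ-∑-comm d (λ ds a → μprod ns ds * shifted ds a) (divisorTuples ns)) ⟩
    μ (n div d) * ∑[ a < d ] sumℤ (map (λ ds → μprod ns ds * shifted ds a) (divisorTuples ns))
      ≡⟨ cong (μ (n div d) *_) (∑-cong d λ a → ∑-μprod*solutions≡coprimeSolutions M ns∣M (r ℕ.+ a ℕ.* (M div d))) ⟩
    μ (n div d) * ∑[ a < d ] Φ (a ℕ.* (M div d)) ∎
    where
    shifted : List ℕ → ℕ → ℤ
    shifted ds a = solutions M ds (r ℕ.+ a ℕ.* (M div d))

divisorTuples-∣ : ∀ {M k} {ns : Vec ℕ k} → All (_∣ M) ns → ListAll.All (ListAll.All (_∣ M)) (divisorTuples ns)
divisorTuples-∣ []                      = [] ∷ []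
divisorTuples-∣ {ns = n ∷ ns} (n∣M ∷ ns∣M) =
  concat⁺ (map⁺ (ListAll.map (λ d∣n → map⁺ (ListAll.map (∣-trans d∣n n∣M ∷_) (divisorTuples-∣ ns∣M)))
                             (all-filter (_∣? n) (applyUpTo suc n))))

f≡coprimeSolutions : ∀ M .{{_ : NonZero M}} {k} {ns : Vec ℕ k} → All (_∣ M) ns → f ns ≡ coprimeSolutions M ns 0
f≡coprimeSolutions M {ns = ns} ns∣M = begin
  sumℤ (map (λ ds → μprod ns ds * + (prodL ds div lcmL ds)) (divisorTuples ns))
    ≡⟨ cong sumℤ (map-cong-local (ListAll.map (cong (μprod ns _ *_) ∘ solutions-at-0) (divisorTuples-∣ ns∣M))) ⟩
  sumℤ (map (λ ds → μprod ns ds * solutions M ds 0) (divisorTuples ns))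
    ≡⟨ ∑-μprod*solutions≡coprimeSolutions M ns∣M 0 ⟩
  coprimeSolutions M ns 0 ∎
  where
  open ≡-Reasoning
  solutions-at-0 : ∀ {ds} → ListAll.All (_∣ M) ds → + (prodL ds div lcmL ds) ≡ solutions M ds 0
  solutions-at-0 {ds} ds∣M = begin
    + (prodL ds div lcmL ds)                            ≡⟨ ℤ.*-identityˡ _ ⟨
    + 1 * + (prodL ds div lcmL ds)                      ≡⟨ cong (_* + (prodL ds div lcmL ds)) (𝟙-yes (M div lcmL ds ∣? 0) (_ ∣0)) ⟨
    𝟙 (M div lcmL ds ∣? 0) * + (prodL ds div lcmL ds)   ≡⟨ solutions≡prod/lcm M ds∣M 0 ⟨
    solutions M ds 0                                    ∎

theorem4p1 : (k : ℕ) → k ≥ 1 → (ns : Vec ℕ k) → All (λ n → n ≥ 1) ns → + 0 ≤ f ns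
theorem4p1 _ _ ns ns≥1 = subst (+ 0 ≤_) (sym (f≡coprimeSolutions M ns∣M)) (0≤coprimeSolutions M ns 0)
  where
  M = product (toList ns)
  instance
    M≢0 : NonZero M
    M≢0 = product≢0 (toList⁺ (All.map ℕ.>-nonZero ns≥1))
  ns∣M : All (_∣ M) ns
  ns∣M = toList⁻ (ListAll.tabulate ∈⇒∣product)
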